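{- Let $G=G_L\otimes G_R$ be a cograph (the join of cographs $G_L=(V_L,E_L)$ and $G_R=(V_R,E_R)$) with restricted vertex set $\mathcal{R}$, let $\mathcal{R}_L=\mathcal{R}\cap V_L$, $\mathcal{R}_R=\mathcal{R}\cap V_R$, and suppose $|\mathcal{R}_L|>|\mathcal{R}_R|$. Let $CMPD_L$ be a canonical $(k_L,s_L,f_L)$-matched-paired-dominating set of $G_L-I(G_L)$ w.r.t. $\mathcal{R}_L-I(G_L)$, and set $\imath_L=|\mathcal{R}_L-V(CMPD_L)|$, $\eta_R=|\mathcal{R}_R|$, $f_R=|V_R|-\eta_R$. Suppose $\imath_L\ge \eta_R+f_R$. Write $V_R=\{v_1,\dots,v_{|V_R|}\}$ and choose distinct vertices $u_1,\dots,u_{|V_R|}\in\mathcal{R}_L-V(CMPD_L)$. Then the $(k_L+\eta_R,\,s_L+f_R,\,0)$-matched-paired-dominating set $$CMPD=K_{G_L}(CMPD_L)\cup S_{G_L}(CMPD_L)\cup\{u_iv_i : 1\le i\le |V_R|\}$$ is a canonical matched-paired-dominating set of $G$ w.r.t. $\mathcal{R}$.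
   Context: All graphs are finite, simple and undirected. A cograph is a graph with no induced path on four vertices. The join $G_L\otimes G_R$ has vertex set $V_L\cup V_R$ ($V_L\cap V_R=\emptyset$) and edge set $E_L\cup E_R\cup\{uv: u\in V_L, v\in V_R\}$. For a graph $H$, $I(H)$ is its set of isolated vertices and $H-I(H)$ is $H$ with them deleted. For a graph $G=(V,E)$ without isolated vertices and $\mathcal{R}\subseteq V$: a set $S\subseteq V$ is a paired-dominating set if every vertex of $V-S$ has a neighbor in $S$ and $G[S]$ has a perfect matching. A set $MPD\subseteq E$ is a matched-paired-dominating set if it is a perfect matching of $G[S]$ for some paired-dominating set $S$; $V(MPD)$ is the set of vertices incident to edges of $MPD$. An edge of $MPD$ is a full-paired-edge if both endpoints lie in $\mathcal{R}$, a semi-paired-edge if exactly one does, and a free-paired-edge if none does. $K_G(MPD)$, $S_G(MPD)$, $F_G(MPD)$ denote the sets of full-, semi-, and free-paired-edges of $MPD$; $MPD$ is a $(k,s,f)$-matched-paired-dominating set if $|K_G(MPD)|=k$, $|S_G(MPD)|=s$, $|F_G(MPD)|=f$. The matched number of $MPD$ is $|V(MPD)\cap\mathcal{R}|$; a maximum matched-paired-dominating set maximizes it; a canonical matched-paired-dominating set w.r.t. $\mathcal{R}$ is a maximum one with the least number of free-paired-edges among all maximum ones. -}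

module Defs where

open import Data.Nat using (ℕ; zero; suc; _+_; _≤_)
open import Data.Bool using (Bool; true; false; _∧_; _∨_; not; if_then_else_)
open import Data.Fin using (Fin; _↑ˡ_; _↑ʳ_; splitAt)
open import Data.Fin.Properties using (_≟_)
open import Data.Fin.Subset using (Subset; _∩_; _─_; ∣_∣; ⊤)
open import Data.Vec using (tabulate; lookup)
open import Data.Bool.ListAction using (any)
open import Data.List using (List; []; _∷_; concatMap; allFin; map; _++_)
open import Data.List.Relation.Unary.Unique.Propositional using (Unique)
open import Data.List.Membership.Propositional using (_∈_)
open import Data.Sum using (_⊎_; inj₁; inj₂)
open import Data.Product using (_×_; _,_; Σ; ∃; proj₁; proj₂)
open import Data.Empty using (⊥)
open import Relation.Nullary.Decidable using (⌊_⌋)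
open import Relation.Binary.PropositionalEquality using (_≡_; refl)

record Graph (n : ℕ) : Set where
  field
    adj    : Fin n → Fin n → Bool
    sym    : ∀ x y → adj x y ≡ adj y x
    irrefl : ∀ x → adj x x ≡ false
open Graph public

Adj : ∀ {n} → Graph n → Fin n → Fin n → Set
Adj G x y = adj G x y ≡ true

-- Cograph: no induced path a-b-c-d on four vertices.
-- (Distinctness of a,b,c,d follows from the edge/non-edge pattern
--  and irreflexivity.)
IsCograph : ∀ {n} → Graph n → Set
IsCograph G = ∀ a b c d →
  adj G a b ≡ true → adj G b c ≡ true → adj G c d ≡ true →
  adj G a c ≡ false → adj G b d ≡ false → adj G a d ≡ false → ⊥

-- Join G_L ⊗ G_R on Fin (nL + nR): left vertices are  a ↑ˡ nR,
-- right vertices are  nL ↑ʳ b.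

joinAdj' : ∀ {nL nR} → Graph nL → Graph nR →
           Fin nL ⊎ Fin nR → Fin nL ⊎ Fin nR → Bool
joinAdj' GL GR (inj₁ a) (inj₁ b) = adj GL a b
joinAdj' GL GR (inj₂ a) (inj₂ b) = adj GR a b
joinAdj' GL GR (inj₁ a) (inj₂ b) = true
joinAdj' GL GR (inj₂ a) (inj₁ b) = true

joinAdj'-sym : ∀ {nL nR} (GL : Graph nL) (GR : Graph nR) x y →
               joinAdj' GL GR x y ≡ joinAdj' GL GR y x
joinAdj'-sym GL GR (inj₁ a) (inj₁ b) = sym GL a b
joinAdj'-sym GL GR (inj₂ a) (inj₂ b) = sym GR a b
joinAdj'-sym GL GR (inj₁ a) (inj₂ b) = refl
joinAdj'-sym GL GR (inj₂ a) (inj₁ b) = refl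

joinAdj'-irrefl : ∀ {nL nR} (GL : Graph nL) (GR : Graph nR) x →
                  joinAdj' GL GR x x ≡ false
joinAdj'-irrefl GL GR (inj₁ a) = irrefl GL a
joinAdj'-irrefl GL GR (inj₂ a) = irrefl GR a

join : ∀ {nL nR} → Graph nL → Graph nR → Graph (nL + nR)
join {nL} GL GR = record
  { adj    = λ x y → joinAdj' GL GR (splitAt nL x) (splitAt nL y)
  ; sym    = λ x y → joinAdj'-sym GL GR (splitAt nL x) (splitAt nL y)
  ; irrefl = λ x → joinAdj'-irrefl GL GR (splitAt nL x)
  }

nonIsolated : ∀ {n} → Graph n → Subset n
nonIsolated {n} G = tabulate (λ x → any (λ y → adj G x y) (allFin n))

-- Sets of matched pairs, represented as lists of (ordered) vertex pairs.

Pair : ℕ → Set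
Pair n = Fin n × Fin n

endpoints : ∀ {n} → List (Pair n) → List (Fin n)
endpoints = concatMap (λ e → proj₁ e ∷ proj₂ e ∷ [])

vset : ∀ {n} → List (Pair n) → Subset n
vset {n} M = tabulate (λ x → any (λ e → ⌊ x ≟ proj₁ e ⌋ ∨ ⌊ x ≟ proj₂ e ⌋) M)

-- MPD is a matched-paired-dominating set of the induced subgraph G[W]:
--  * every pair is an edge of G[W],
--  * the pairs are vertex-disjoint (perfect matching of G[S], S = V(MPD)),
--  * every vertex of W - S has a neighbour in S.
record IsMPD {n} (G : Graph n) (W : Subset n) (M : List (Pair n)) : Set where
  field
    edges    : ∀ {u v} → (u , v) ∈ M →
               Adj G u v × lookup W u ≡ true × lookup W v ≡ true
    disjoint : Unique (endpoints M)
    dominate : ∀ x → lookup W x ≡ true → lookup (vset M) x ≡ false →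
               Σ (Fin n) λ y → lookup (vset M) y ≡ true × Adj G x y

countB : ∀ {A : Set} → (A → Bool) → List A → ℕ
countB p []       = 0
countB p (x ∷ xs) = if p x then suc (countB p xs) else countB p xs

filterB : ∀ {A : Set} → (A → Bool) → List A → List A
filterB p []       = []
filterB p (x ∷ xs) = if p x then x ∷ filterB p xs else filterB p xs

module _ {n : ℕ} (R : Subset n) where
  isFull isSemi isFree : Pair n → Bool
  isFull e = lookup R (proj₁ e) ∧ lookup R (proj₂ e)
  isSemi e = (lookup R (proj₁ e) ∧ not (lookup R (proj₂ e)))
           ∨ (not (lookup R (proj₁ e)) ∧ lookup R (proj₂ e))
  isFree e = not (lookup R (proj₁ e)) ∧ not (lookup R (proj₂ e))

  numFull numSemi numFree : List (Pair n) → ℕ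
  numFull = countB isFull
  numSemi = countB isSemi
  numFree = countB isFree

  fullSemi : List (Pair n) → List (Pair n)
  fullSemi = filterB (λ e → not (isFree e))

  matchedNum : List (Pair n) → ℕ
  matchedNum M = ∣ vset M ∩ R ∣

IsMaxMPD : ∀ {n} → Graph n → Subset n → Subset n → List (Pair n) → Set
IsMaxMPD G W R M = IsMPD G W M ×
  (∀ M' → IsMPD G W M' → matchedNum R M' ≤ matchedNum R M)

IsCanonicalMPD : ∀ {n} → Graph n → Subset n → Subset n → List (Pair n) → Set
IsCanonicalMPD G W R M = IsMaxMPD G W R M ×
  (∀ M' → IsMaxMPD G W R M' → numFree R M ≤ numFree R M')

restrictL : ∀ {nL nR} → Subset (nL + nR) → Subset nL
restrictL {nL} {nR} R = tabulate (λ a → lookup R (a ↑ˡ nR))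

restrictR : ∀ {nL nR} → Subset (nL + nR) → Subset nR
restrictR {nL} {nR} R = tabulate (λ b → lookup R (nL ↑ʳ b))

liftL : ∀ {nL} nR → Pair nL → Pair (nL + nR)
liftL nR e = (proj₁ e ↑ˡ nR , proj₂ e ↑ˡ nR)

constructedCMPD : ∀ {nL nR} → Subset nL → List (Pair nL) → (Fin nR → Fin nL) →
                  List (Pair (nL + nR))
constructedCMPD {nL} {nR} RL ML u =
  map (liftL nR) (fullSemi RL ML) ++ map (λ i → (u i ↑ˡ nR , nL ↑ʳ i)) (allFin nR)

-- The construction C is a paired-dominating matching of the join: every left vertex sees the
-- matched right vertex v₁, and every right vertex is matched. For maximality take any
-- paired-dominating matching M of the join. Its pairs inside G_L form a matching of G_L, which
-- extends greedily to a paired-dominating matching of G_L − I(G_L); by maximality of CMPD_L they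
-- cover at most |V(CMPD_L) ∩ R_L| restricted vertices. Every other pair of M has a right endpoint,
-- which pays for the at most one restricted left vertex of the pair, so the rest of M covers at most
-- |V_R| + |R_R| restricted vertices. C covers exactly that many, and it has no free pairs, so it
-- is canonical.
module Submission where

open import Defs hiding (sym)
open import Data.Bool as Bool using (Bool; true; false; _∨_; not)
open import Data.Bool.ListAction using (any)
open import Data.Bool.Properties using (T-≡; ∨-identityʳ)
open import Data.Fin using (Fin; zero; suc; _↑ˡ_; _↑ʳ_; splitAt)
open import Data.Fin.Properties
  using (_≟_; any?; splitAt-↑ˡ; splitAt-↑ʳ; splitAt⁻¹-↑ˡ; splitAt⁻¹-↑ʳ; ↑ˡ-injective; ↑ʳ-injective)
open import Data.Fin.Subset using (Subset; _∩_; _─_; _-_; ∣_∣; ⊤; ⊥; ∁; inside; outside)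
  renaming (_∈_ to _∈ₛ_; _⊆_ to _⊆ₛ_)
open import Data.Fin.Subset.Properties
  using (p⊆q⇒∣p∣≤∣q∣; x∈p⇒∣p-x∣<∣p∣; x∈p∧x≢y⇒x∈p-y; ∣p∩q∣≤∣q∣; ∣⊤∣≡n; ∣⊥∣≡0; ∣∁p∣≡n∸∣p∣;
         Empty-unique; x∈p∩q⁺; x∈p∩q⁻)
open import Data.List as List using (List; []; _∷_; _++_; map; length; allFin)
open import Data.List.Properties using (length-tabulate)
open import Data.List.Membership.Propositional using (_∈_)
open import Data.List.Membership.Propositional.Properties
  using (∉[]; ∈-allFin; ∈-map⁺; ∈-map⁻; ∈-++⁻; ∈-++⁺ʳ)
import Data.List.Membership.DecPropositional as DecMembership
open import Data.List.Relation.Binary.Subset.Propositional using (_⊆_)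
open import Data.List.Relation.Binary.Sublist.Propositional using ([]; _∷_; _∷ʳ_)
  renaming (_⊆_ to _⊑_)
open import Data.List.Relation.Binary.Sublist.Propositional.Properties using (All-resp-⊆; Any-resp-⊆)
open import Data.List.Relation.Unary.All as All using (All; []; _∷_)
open import Data.List.Relation.Unary.AllPairs using ([]; _∷_)
open import Data.List.Relation.Unary.Any as Any using (here; there)
open import Data.List.Relation.Unary.Any.Properties using (any⁺; any⁻)
open import Data.List.Relation.Unary.Unique.Propositional using (Unique)
import Data.List.Relation.Unary.Unique.Propositional.Properties as Unique
open import Data.Nat using (ℕ; zero; suc; _+_; _∸_; _≤_; _<_; z≤n; s≤s)
open import Data.Nat.Properties
  using (+-commutativeSemigroup; ≤-refl; ≤-trans; ≤-reflexive; ≤-antisym; n≤1+n; m≤m+n; m≤n+m;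
         +-mono-≤; +-suc; module ≤-Reasoning)
open import Algebra.Properties.CommutativeSemigroup +-commutativeSemigroup using (interchange)
open import Data.Product as Product using (_×_; _,_; Σ; ∃; proj₁; proj₂)
open import Data.Sum using (_⊎_; inj₁; inj₂)
open import Data.Vec as Vec using (_∷_; lookup)
open import Data.Vec.Properties
  using (lookup∘tabulate; tabulate∘lookup; lookup⇒[]=; []=⇒lookup; lookup∘update; lookup∘update′;
         lookup-++ˡ; lookup-++ʳ; lookup-replicate; lookup-map)
open import Function using (id; _∘_; Equivalence)
open import Function.Definitions using (Injective)
open import Relation.Binary.PropositionalEquality
  using (_≡_; _≢_; refl; sym; trans; cong; cong₂; subst; _≗_; module ≡-Reasoning)
open import Relation.Nullary using (¬_; yes; no; contradiction)
open import Relation.Nullary.Decidable using (⌊_⌋; _×-dec_)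

private variable
  A B : Set
  n : ℕ

module _ (p : A → Bool) where

  countB-++ : ∀ xs ys → countB p (xs ++ ys) ≡ countB p xs + countB p ys
  countB-++ []       ys = refl
  countB-++ (x ∷ xs) ys with p x
  ... | true  = cong suc (countB-++ xs ys)
  ... | false = countB-++ xs ys

  countB-∷-≤ : ∀ x xs → countB p (x ∷ xs) ≤ suc (countB p xs)
  countB-∷-≤ x xs with p x
  ... | true  = ≤-refl
  ... | false = n≤1+n _

  countB-swap : ∀ x y xs → countB p (x ∷ y ∷ xs) ≡ countB p (y ∷ x ∷ xs)
  countB-swap x y xs with p x | p y
  ... | true  | true  = refl
  ... | true  | false = refl
  ... | false | true  = refl
  ... | false | false = refl

  countB≡length-filterB : ∀ xs → countB p xs ≡ length (filterB p xs)
  countB≡length-filterB []       = refl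
  countB≡length-filterB (x ∷ xs) with p x
  ... | true  = cong suc (countB≡length-filterB xs)
  ... | false = countB≡length-filterB xs

  countB-filterB-not : ∀ xs → countB p (filterB (not ∘ p) xs) ≡ 0
  countB-filterB-not []       = refl
  countB-filterB-not (x ∷ xs) with p x in px
  ... | true  = countB-filterB-not xs
  ... | false rewrite px = countB-filterB-not xs

  filterB-⊑ : ∀ xs → filterB p xs ⊑ xs
  filterB-⊑ []       = []
  filterB-⊑ (x ∷ xs) with p x
  ... | true  = refl ∷ filterB-⊑ xs
  ... | false = x ∷ʳ filterB-⊑ xs

  ∈-filterB⁻ : ∀ {x} xs → x ∈ filterB p xs → x ∈ xs × p x ≡ true
  ∈-filterB⁻ (y ∷ xs) x∈ with p y in py
  ∈-filterB⁻ (y ∷ xs) (here refl) | true = here refl , py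
  ∈-filterB⁻ (y ∷ xs) (there x∈)  | true = Product.map₁ there (∈-filterB⁻ xs x∈)
  ... | false = Product.map₁ there (∈-filterB⁻ xs x∈)

  ∈-filterB⁺ : ∀ {x} xs → x ∈ xs → p x ≡ true → x ∈ filterB p xs
  ∈-filterB⁺ (y ∷ xs) (here refl) px rewrite px = here refl
  ∈-filterB⁺ (y ∷ xs) (there x∈)  px with p y
  ... | true  = there (∈-filterB⁺ xs x∈ px)
  ... | false = ∈-filterB⁺ xs x∈ px

countB-filterB-⊇ : ∀ (p q : A → Bool) → (∀ x → p x ≡ true → q x ≡ true) →
                   ∀ xs → countB p (filterB q xs) ≡ countB p xs
countB-filterB-⊇ p q kept []       = refl
countB-filterB-⊇ p q kept (x ∷ xs) with q x in qx
... | true with p x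
...   | true  = cong suc (countB-filterB-⊇ p q kept xs)
...   | false = countB-filterB-⊇ p q kept xs
countB-filterB-⊇ p q kept (x ∷ xs) | false with p x in px
...   | true  = contradiction (trans (sym (kept x px)) qx) λ ()
...   | false = countB-filterB-⊇ p q kept xs

countB-false : ∀ {p : A → Bool} → (∀ x → p x ≡ false) → ∀ xs → countB p xs ≡ 0
countB-false never []       = refl
countB-false never (x ∷ xs) rewrite never x = countB-false never xs

countB-map : ∀ (p : B → Bool) (f : A → B) xs → countB p (map f xs) ≡ countB (p ∘ f) xs
countB-map p f []       = refl
countB-map p f (x ∷ xs) with p (f x)
... | true  = cong suc (countB-map p f xs)
... | false = countB-map p f xs

countB-cong : ∀ {p q : A → Bool} → p ≗ q → ∀ xs → countB p xs ≡ countB q xs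
countB-cong         p≗q []       = refl
countB-cong {q = q} p≗q (x ∷ xs) rewrite p≗q x with q x
... | true  = cong suc (countB-cong p≗q xs)
... | false = countB-cong p≗q xs

countB-tabulate : ∀ (p : A → Bool) (f : Fin n → A) → countB p (List.tabulate f) ≡ ∣ Vec.tabulate (p ∘ f) ∣
countB-tabulate {n = zero}  p f = refl
countB-tabulate {n = suc n} p f with p (f zero)
... | true  = cong suc (countB-tabulate p (f ∘ suc))
... | false = countB-tabulate p (f ∘ suc)

countB-allFin : ∀ (q : Subset n) → countB (lookup q) (allFin n) ≡ ∣ q ∣
countB-allFin q = trans (countB-tabulate (lookup q) id) (cong ∣_∣ (tabulate∘lookup q))

Unique-resp-⊑ : ∀ {xs ys : List A} → xs ⊑ ys → Unique ys → Unique xs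
Unique-resp-⊑ []             []            = []
Unique-resp-⊑ (y ∷ʳ xs⊑ys)   (_ ∷ uniq)    = Unique-resp-⊑ xs⊑ys uniq
Unique-resp-⊑ (refl ∷ xs⊑ys) (y∉ys ∷ uniq) = All-resp-⊆ xs⊑ys y∉ys ∷ Unique-resp-⊑ xs⊑ys uniq

∣p∣≤1+∣p[x]≔outside∣ : ∀ (p : Subset n) x → ∣ p ∣ ≤ suc ∣ p Vec.[ x ]≔ outside ∣
∣p∣≤1+∣p[x]≔outside∣ (inside  ∷ p) zero    = ≤-refl
∣p∣≤1+∣p[x]≔outside∣ (outside ∷ p) zero    = n≤1+n _
∣p∣≤1+∣p[x]≔outside∣ (inside  ∷ p) (suc x) = s≤s (∣p∣≤1+∣p[x]≔outside∣ p x)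
∣p∣≤1+∣p[x]≔outside∣ (outside ∷ p) (suc x) = ∣p∣≤1+∣p[x]≔outside∣ p x

∈-[]≔outside⁻ : ∀ {p : Subset n} {x y} → x ∈ₛ p Vec.[ y ]≔ outside → x ∈ₛ p × x ≢ y
∈-[]≔outside⁻ {p = p} {x} {y} x∈ with x ≟ y
... | yes refl = contradiction (trans (sym (lookup∘update x p outside)) ([]=⇒lookup x∈)) λ ()
... | no x≢y   = lookup⇒[]= x p (trans (sym (lookup∘update′ x≢y p outside)) ([]=⇒lookup x∈)) , x≢y

∣p∣≤length : ∀ (p : Subset n) xs → (∀ {x} → x ∈ₛ p → x ∈ xs) → ∣ p ∣ ≤ length xs
∣p∣≤length {n} p [] p⊆[] =
  ≤-reflexive (trans (cong ∣_∣ (Empty-unique λ (_ , x∈p) → ∉[] (p⊆[] x∈p))) (∣⊥∣≡0 n))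
∣p∣≤length p (y ∷ xs) p⊆y∷xs =
  ≤-trans (∣p∣≤1+∣p[x]≔outside∣ p y) (s≤s (∣p∣≤length _ xs p′⊆xs))
  where
  p′⊆xs : ∀ {x} → x ∈ₛ p Vec.[ y ]≔ outside → x ∈ xs
  p′⊆xs x∈p′ with ∈-[]≔outside⁻ x∈p′
  ... | x∈p , x≢y with p⊆y∷xs x∈p
  ...   | here x≡y   = contradiction x≡y x≢y
  ...   | there x∈xs = x∈xs

length≤∣p∣ : ∀ (p : Subset n) {xs} → Unique xs → (∀ {x} → x ∈ xs → x ∈ₛ p) → length xs ≤ ∣ p ∣
length≤∣p∣ p           []            xs⊆p   = z≤n
length≤∣p∣ p {y ∷ xs} (y∉xs ∷ uniq) y∷xs⊆p =
  ≤-trans (s≤s (length≤∣p∣ (p - y) uniq xs⊆p-y)) (x∈p⇒∣p-x∣<∣p∣ (y∷xs⊆p (here refl)))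
  where
  xs⊆p-y : ∀ {x} → x ∈ xs → x ∈ₛ p - y
  xs⊆p-y x∈xs = x∈p∧x≢y⇒x∈p-y (y∷xs⊆p (there x∈xs)) (All.lookup y∉xs x∈xs ∘ sym)

∣p∣≡length : ∀ (p : Subset n) {xs} → Unique xs →
             (∀ {x} → x ∈ₛ p → x ∈ xs) → (∀ {x} → x ∈ xs → x ∈ₛ p) → ∣ p ∣ ≡ length xs
∣p∣≡length p uniq p⊆xs xs⊆p = ≤-antisym (∣p∣≤length p _ p⊆xs) (length≤∣p∣ p uniq xs⊆p)

endpoints-++ : ∀ (M M′ : List (Pair n)) → endpoints (M ++ M′) ≡ endpoints M ++ endpoints M′
endpoints-++ []            M′ = refl
endpoints-++ ((a , b) ∷ M) M′ = cong (λ ends → a ∷ b ∷ ends) (endpoints-++ M M′)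

endpoints-⊑ : ∀ {M M′ : List (Pair n)} → M ⊑ M′ → endpoints M ⊑ endpoints M′
endpoints-⊑ []            = []
endpoints-⊑ (e ∷ʳ M⊑M′)   = proj₁ e ∷ʳ proj₂ e ∷ʳ endpoints-⊑ M⊑M′
endpoints-⊑ (refl ∷ M⊑M′) = refl ∷ refl ∷ endpoints-⊑ M⊑M′

∈-endpoints⁺ : ∀ {a b : Fin n} {M} → (a , b) ∈ M → a ∈ endpoints M × b ∈ endpoints M
∈-endpoints⁺ (here refl) = here refl , there (here refl)
∈-endpoints⁺ (there e∈M) = Product.map (there ∘ there) (there ∘ there) (∈-endpoints⁺ e∈M)

∈-endpoints⁻ : ∀ {x : Fin n} M → x ∈ endpoints M → ∃ λ e → e ∈ M × (x ≡ proj₁ e ⊎ x ≡ proj₂ e)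
∈-endpoints⁻ (e ∷ M) (here x≡a)         = e , here refl , inj₁ x≡a
∈-endpoints⁻ (e ∷ M) (there (here x≡b)) = e , here refl , inj₂ x≡b
∈-endpoints⁻ (e ∷ M) (there (there x∈)) with ∈-endpoints⁻ M x∈
... | e′ , e′∈M , x∈e′ = e′ , there e′∈M , x∈e′

endpoints-⊆ : ∀ {M M′ : List (Pair n)} → M ⊆ M′ → endpoints M ⊆ endpoints M′
endpoints-⊆ {M = M} M⊆M′ x∈ with ∈-endpoints⁻ M x∈
... | e , e∈M , inj₁ refl = proj₁ (∈-endpoints⁺ (M⊆M′ e∈M))
... | e , e∈M , inj₂ refl = proj₂ (∈-endpoints⁺ (M⊆M′ e∈M))

∈-endpoints-map⁻ : ∀ {f g : A → Fin n} is {z} → z ∈ endpoints (map (λ i → f i , g i) is) →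
                   ∃ λ j → j ∈ is × (z ≡ f j ⊎ z ≡ g j)
∈-endpoints-map⁻ {f = f} {g} is z∈ with ∈-endpoints⁻ (map (λ i → f i , g i) is) z∈
... | _ , e∈ , z∈e with ∈-map⁻ (λ i → f i , g i) e∈
...   | j , j∈is , refl = j , j∈is , z∈e

Unique-endpoints-map : ∀ {f g : A → Fin n} → Injective _≡_ _≡_ f → Injective _≡_ _≡_ g →
                       (∀ i j → f i ≢ g j) →
                       ∀ {is} → Unique is → Unique (endpoints (map (λ i → f i , g i) is))
Unique-endpoints-map f-inj g-inj f≢g [] = []
Unique-endpoints-map {f = f} {g} f-inj g-inj f≢g {i ∷ is} (i∉is ∷ uniq) =
  (f≢g i i ∷ All.tabulate fi∉) ∷ All.tabulate gi∉ ∷ Unique-endpoints-map f-inj g-inj f≢g uniq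
  where
  fi∉ : ∀ {z} → z ∈ endpoints (map (λ i → f i , g i) is) → f i ≢ z
  fi∉ z∈ with ∈-endpoints-map⁻ is z∈
  ... | j , j∈is , inj₁ refl = All.lookup i∉is j∈is ∘ f-inj
  ... | j , j∈is , inj₂ refl = f≢g i j
  gi∉ : ∀ {z} → z ∈ endpoints (map (λ i → f i , g i) is) → g i ≢ z
  gi∉ z∈ with ∈-endpoints-map⁻ is z∈
  ... | j , j∈is , inj₁ refl = f≢g j i ∘ sym
  ... | j , j∈is , inj₂ refl = All.lookup i∉is j∈is ∘ g-inj

countB-endpoints-filterB : ∀ (p : Fin n → Bool) (c : Pair n → Bool) M →
  (∀ e → c e ≡ false → p (proj₁ e) ≡ false × p (proj₂ e) ≡ false) →
  countB p (endpoints (filterB c M)) ≡ countB p (endpoints M)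
countB-endpoints-filterB p c []            dropped = refl
countB-endpoints-filterB p c ((a , b) ∷ M) dropped with c (a , b) in kept
... | true = trans (countB-++ p (a ∷ b ∷ []) (endpoints (filterB c M)))
                   (trans (cong (countB p (a ∷ b ∷ []) +_) (countB-endpoints-filterB p c M dropped))
                          (sym (countB-++ p (a ∷ b ∷ []) (endpoints M))))
... | false rewrite proj₁ (dropped (a , b) kept) | proj₂ (dropped (a , b) kept) =
  countB-endpoints-filterB p c M dropped

module _ {x : Fin n} where

  private
    covers : Pair n → Bool
    covers e = ⌊ x ≟ proj₁ e ⌋ ∨ ⌊ x ≟ proj₂ e ⌋

  ∈-vset⁻ : ∀ M → x ∈ₛ vset M → x ∈ endpoints M
  ∈-vset⁻ M x∈ = go M (trans (sym (lookup∘tabulate _ x)) ([]=⇒lookup x∈))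
    where
    go : ∀ M → any covers M ≡ true → x ∈ endpoints M
    go (e ∷ M) hit with x ≟ proj₁ e
    ... | yes x≡a = here x≡a
    ... | no _ with x ≟ proj₂ e
    ...   | yes x≡b = there (here x≡b)
    ...   | no _    = there (there (go M hit))

  ∈-vset⁺ : ∀ M → x ∈ endpoints M → x ∈ₛ vset M
  ∈-vset⁺ M x∈ = lookup⇒[]= x (vset M) (trans (lookup∘tabulate _ x) (go M x∈))
    where
    go : ∀ M → x ∈ endpoints M → any covers M ≡ true
    go (e ∷ M) x∈ with x ≟ proj₁ e
    ... | yes _ = refl
    ... | no x≢a with x ≟ proj₂ e | x∈
    ...   | yes _  | _                 = refl
    ...   | no _   | here x≡a          = contradiction x≡a x≢a
    ...   | no x≢b | there (here x≡b)  = contradiction x≡b x≢b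
    ...   | no _   | there (there x∈′) = go M x∈′

matchedNum≡countB : ∀ (R : Subset n) M → Unique (endpoints M) →
                    matchedNum R M ≡ countB (lookup R) (endpoints M)
matchedNum≡countB R M uniq = trans
  (∣p∣≡length (vset M ∩ R) (Unique-resp-⊑ (filterB-⊑ (lookup R) (endpoints M)) uniq) hit⁺ hit⁻)
  (sym (countB≡length-filterB (lookup R) (endpoints M)))
  where
  hit⁺ : ∀ {x} → x ∈ₛ vset M ∩ R → x ∈ filterB (lookup R) (endpoints M)
  hit⁺ x∈ with x∈p∩q⁻ (vset M) R x∈
  ... | x∈M , x∈R = ∈-filterB⁺ (lookup R) (endpoints M) (∈-vset⁻ M x∈M) ([]=⇒lookup x∈R)
  hit⁻ : ∀ {x} → x ∈ filterB (lookup R) (endpoints M) → x ∈ₛ vset M ∩ R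
  hit⁻ x∈ with ∈-filterB⁻ (lookup R) (endpoints M) x∈
  ... | x∈M , x∈R = x∈p∩q⁺ (∈-vset⁺ M x∈M , lookup⇒[]= _ R x∈R)

countB-endpoints≤∣_∣ : ∀ (q : Subset n) M → Unique (endpoints M) →
                       countB (lookup q) (endpoints M) ≤ ∣ q ∣
countB-endpoints≤∣ q ∣ M uniq =
  ≤-trans (≤-reflexive (sym (matchedNum≡countB q M uniq))) (∣p∩q∣≤∣q∣ (vset M) q)

module _ {n : ℕ} (q : Subset n) where

  full⇒notFree : ∀ e → isFull q e ≡ true → not (isFree q e) ≡ true
  full⇒notFree (a , b) full with lookup q a | lookup q b
  ... | true  | _     = refl
  ... | false | true  = refl
  ... | false | false = full

  semi⇒notFree : ∀ e → isSemi q e ≡ true → not (isFree q e) ≡ true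
  semi⇒notFree (a , b) semi with lookup q a | lookup q b
  ... | true  | _     = refl
  ... | false | true  = refl
  ... | false | false = semi

  free⇒outside : ∀ e → not (isFree q e) ≡ false → lookup q (proj₁ e) ≡ false × lookup q (proj₂ e) ≡ false
  free⇒outside (a , b) free with lookup q a | lookup q b
  ... | false | false = refl , refl
  ... | true  | _     = contradiction free λ ()
  ... | false | true  = contradiction free λ ()

-- Greedy extension of a matching to a paired-dominating set of G − I(G)

IsMPD-endpoints : ∀ {G : Graph n} {W M x} → IsMPD G W M → x ∈ endpoints M → lookup W x ≡ true
IsMPD-endpoints {M = M} mpd x∈ with ∈-endpoints⁻ M x∈
... | e , e∈M , inj₁ refl = proj₁ (proj₂ (IsMPD.edges mpd e∈M))
... | e , e∈M , inj₂ refl = proj₂ (proj₂ (IsMPD.edges mpd e∈M))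

module _ (G : Graph n) where

  open DecMembership (_≟_ {n}) using (_∈?_)

  adj⇒nonIsolated : ∀ {x y} → Adj G x y → lookup (nonIsolated G) x ≡ true
  adj⇒nonIsolated {x} {y} xy = trans (lookup∘tabulate _ x)
    (Equivalence.to T-≡ (any⁺ (adj G x) (Any.map (λ { refl → Equivalence.from T-≡ xy }) (∈-allFin y))))

  nonIsolated⇒neighbour : ∀ {x} → lookup (nonIsolated G) x ≡ true → ∃ λ y → Adj G x y
  nonIsolated⇒neighbour {x} nonIso = Product.map₂ (Equivalence.to T-≡)
    (Any.satisfied (any⁻ (adj G x) (allFin n)
      (Equivalence.from T-≡ (trans (sym (lookup∘tabulate _ x)) nonIso))))

  IsMatching : List (Pair n) → Set
  IsMatching M = (∀ {u v} → (u , v) ∈ M → Adj G u v) × Unique (endpoints M)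

  Settled : List (Pair n) → Fin n → Set
  Settled M x = x ∈ endpoints M ⊎ (∃ λ y → Adj G x y × y ∈ endpoints M) ⊎ (¬ ∃ λ y → Adj G x y)

  Settled-⊆ : ∀ {M M′} → M ⊆ M′ → ∀ {x} → Settled M x → Settled M′ x
  Settled-⊆ M⊆M′ (inj₁ x∈)                   = inj₁ (endpoints-⊆ M⊆M′ x∈)
  Settled-⊆ M⊆M′ (inj₂ (inj₁ (y , xy , y∈))) = inj₂ (inj₁ (y , xy , endpoints-⊆ M⊆M′ y∈))
  Settled-⊆ M⊆M′ (inj₂ (inj₂ isolated))      = inj₂ (inj₂ isolated)

  Extension : List (Pair n) → (List (Pair n) → Set) → Set
  Extension M P = Σ (List (Pair n)) λ M′ → IsMatching M′ × M ⊆ M′ × P M′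

  settle : ∀ M x → IsMatching M → Extension M (λ M′ → Settled M′ x)
  settle M x matching with x ∈? endpoints M
  ... | yes x∈ = M , matching , id , inj₁ x∈
  ... | no x∉ with any? (λ y → (adj G x y Bool.≟ true) ×-dec (y ∈? endpoints M))
  ...   | yes dominated = M , matching , id , inj₂ (inj₁ dominated)
  ...   | no undominated with any? (λ y → adj G x y Bool.≟ true)
  ...     | no isolated  = M , matching , id , inj₂ (inj₂ isolated)
  ...     | yes (y , xy) = (x , y) ∷ M , (edges′ , unique′) , there , inj₁ (here refl)
    where
    x≢y : x ≢ y
    x≢y refl = contradiction (trans (sym xy) (irrefl G x)) λ ()
    edges′ : ∀ {u v} → (u , v) ∈ (x , y) ∷ M → Adj G u v
    edges′ (here refl) = xy
    edges′ (there uv∈) = proj₁ matching uv∈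
    -- y is unmatched because x is undominated
    unique′ : Unique (x ∷ y ∷ endpoints M)
    unique′ = (x≢y ∷ All.tabulate (λ z∈ x≡z → x∉ (subst (_∈ _) (sym x≡z) z∈)))
            ∷ All.tabulate (λ z∈ y≡z → undominated (y , xy , subst (_∈ _) (sym y≡z) z∈))
            ∷ proj₂ matching

  settleAll : ∀ M xs → IsMatching M → Extension M (λ M′ → All (Settled M′) xs)
  settleAll M []       matching = M , matching , id , []
  settleAll M (x ∷ xs) matching with settle M x matching
  ... | M₁ , matching₁ , M⊆M₁ , x-settled with settleAll M₁ xs matching₁
  ...   | M₂ , matching₂ , M₁⊆M₂ , xs-settled =
    M₂ , matching₂ , M₁⊆M₂ ∘ M⊆M₁ , Settled-⊆ M₁⊆M₂ x-settled ∷ xs-settled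

  settled⇒IsMPD : ∀ {M} → IsMatching M → All (Settled M) (allFin n) → IsMPD G (nonIsolated G) M
  settled⇒IsMPD {M} (edges , unique) settled = record
    { edges    = λ uv∈ → edges uv∈ , adj⇒nonIsolated (edges uv∈)
                                   , adj⇒nonIsolated (trans (Graph.sym G _ _) (edges uv∈))
    ; disjoint = unique
    ; dominate = dominate
    }
    where
    dominate : ∀ x → lookup (nonIsolated G) x ≡ true → lookup (vset M) x ≡ false →
               Σ (Fin n) λ y → lookup (vset M) y ≡ true × Adj G x y
    dominate x nonIso x∉M with All.lookup settled (∈-allFin x)
    ... | inj₁ x∈                   = contradiction (trans (sym ([]=⇒lookup (∈-vset⁺ M x∈))) x∉M) λ ()
    ... | inj₂ (inj₁ (y , xy , y∈)) = y , []=⇒lookup (∈-vset⁺ M y∈) , xy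
    ... | inj₂ (inj₂ isolated)      = contradiction (nonIsolated⇒neighbour nonIso) isolated

  extend : ∀ M → IsMatching M → Σ (List (Pair n)) λ M′ → IsMPD G (nonIsolated G) M′ × M ⊆ M′
  extend M matching with settleAll M (allFin n) matching
  ... | M′ , matching′ , M⊆M′ , settled = M′ , settled⇒IsMPD matching′ settled , M⊆M′

-- The join G_L ⊗ G_R

module _ {m k : ℕ} where

  data Side : Fin (m + k) → Set where
    left  : (a : Fin m) → Side (a ↑ˡ k)
    right : (b : Fin k) → Side (m ↑ʳ b)

  side : ∀ x → Side x
  side x with splitAt m x in eq
  ... | inj₁ a = subst Side (splitAt⁻¹-↑ˡ eq) (left a)
  ... | inj₂ b = subst Side (splitAt⁻¹-↑ʳ eq) (right b)

  ↑ˡ≢↑ʳ : ∀ (a : Fin m) (b : Fin k) → a ↑ˡ k ≢ m ↑ʳ b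
  ↑ˡ≢↑ʳ a b eq with trans (sym (splitAt-↑ˡ m a k)) (trans (cong (splitAt m) eq) (splitAt-↑ʳ m k b))
  ... | ()

  module _ (GL : Graph m) (GR : Graph k) where

    adj-join-↑ˡ : ∀ a b → adj (join GL GR) (a ↑ˡ k) (b ↑ˡ k) ≡ adj GL a b
    adj-join-↑ˡ a b rewrite splitAt-↑ˡ m a k | splitAt-↑ˡ m b k = refl

    adj-join-↑ˡ↑ʳ : ∀ a b → adj (join GL GR) (a ↑ˡ k) (m ↑ʳ b) ≡ true
    adj-join-↑ˡ↑ʳ a b rewrite splitAt-↑ˡ m a k | splitAt-↑ʳ m k b = refl

  lookup-restrictL : ∀ (R : Subset (m + k)) a → lookup (restrictL {m} {k} R) a ≡ lookup R (a ↑ˡ k)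
  lookup-restrictL R = lookup∘tabulate _

  lookup-restrictR : ∀ (R : Subset (m + k)) b → lookup (restrictR {m} {k} R) b ≡ lookup R (m ↑ʳ b)
  lookup-restrictR R = lookup∘tabulate _

  onRight : Subset k → Subset (m + k)
  onRight q = ⊥ Vec.++ q

  lookup-onRight-↑ˡ : ∀ q a → lookup (onRight q) (a ↑ˡ k) ≡ false
  lookup-onRight-↑ˡ q a = trans (lookup-++ˡ (⊥ {m}) q a) (lookup-replicate a false)

  lookup-onRight-↑ʳ : ∀ q b → lookup (onRight q) (m ↑ʳ b) ≡ lookup q b
  lookup-onRight-↑ʳ q b = lookup-++ʳ (⊥ {m}) q b

  ∣onRight∣ : ∀ q → ∣ onRight q ∣ ≡ ∣ q ∣
  ∣onRight∣ q = go m
    where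
    go : ∀ m′ → ∣ ⊥ {m′} Vec.++ q ∣ ≡ ∣ q ∣
    go zero     = refl
    go (suc m′) = go m′

  endpoints-liftL : ∀ (M : List (Pair m)) → endpoints (map (liftL k) M) ≡ map (_↑ˡ k) (endpoints M)
  endpoints-liftL []            = refl
  endpoints-liftL ((a , b) ∷ M) = cong (λ ends → (a ↑ˡ k) ∷ (b ↑ˡ k) ∷ ends) (endpoints-liftL M)

  leftPart : Fin (m + k) → Fin (m + k) → List (Pair m)
  leftPart x y with side x | side y
  ... | left a | left b = (a , b) ∷ []
  ... | _      | _      = []

  leftPairs : List (Pair (m + k)) → List (Pair m)
  leftPairs []            = []
  leftPairs ((x , y) ∷ M) = leftPart x y ++ leftPairs M

  leftPairs-⊑ : ∀ M → map (liftL k) (leftPairs M) ⊑ M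
  leftPairs-⊑ []            = []
  leftPairs-⊑ ((x , y) ∷ M) with side x | side y
  ... | left a  | left b  = refl ∷ leftPairs-⊑ M
  ... | left a  | right b = (a ↑ˡ k , m ↑ʳ b) ∷ʳ leftPairs-⊑ M
  ... | right a | left b  = (m ↑ʳ a , b ↑ˡ k) ∷ʳ leftPairs-⊑ M
  ... | right a | right b = (m ↑ʳ a , m ↑ʳ b) ∷ʳ leftPairs-⊑ M

  leftPairs-isMatching : ∀ (GL : Graph m) (GR : Graph k) {M} → IsMPD (join GL GR) ⊤ M →
                         IsMatching GL (leftPairs M)
  leftPairs-isMatching GL GR {M} mpd = edges , unique
    where
    edges : ∀ {a b} → (a , b) ∈ leftPairs M → Adj GL a b
    edges {a} {b} ab∈ = trans (sym (adj-join-↑ˡ GL GR a b))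
      (proj₁ (IsMPD.edges mpd (Any-resp-⊆ (leftPairs-⊑ M) (∈-map⁺ (liftL k) ab∈))))
    unique : Unique (endpoints (leftPairs M))
    unique = Unique.map⁻ (subst Unique (endpoints-liftL (leftPairs M))
      (Unique-resp-⊑ (endpoints-⊑ (leftPairs-⊑ M)) (IsMPD.disjoint mpd)))

  module Restricted (R : Subset (m + k)) where

    RL : Subset m
    RL = restrictL {m} {k} R

    RR : Subset k
    RR = restrictR {m} {k} R

    -- A pair inside G_L is counted through leftPairs; any other pair has a right endpoint,
    -- which pays for the at most one restricted left endpoint of the pair.
    charge-pair : ∀ x y → countB (lookup R) (x ∷ y ∷ []) ≤
      countB (lookup RL) (endpoints (leftPart x y)) +
      (countB (lookup (onRight ⊤)) (x ∷ y ∷ []) + countB (lookup (onRight RR)) (x ∷ y ∷ []))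
    charge-pair x y with side x | side y
    ... | left a  | left b
      rewrite lookup-onRight-↑ˡ ⊤ a | lookup-onRight-↑ˡ ⊤ b | lookup-onRight-↑ˡ RR a | lookup-onRight-↑ˡ RR b
            | lookup-restrictL R a | lookup-restrictL R b
            = m≤m+n _ 0
    ... | left a  | right b
      rewrite lookup-onRight-↑ˡ ⊤ a | lookup-onRight-↑ʳ ⊤ b | lookup-replicate b inside
            | lookup-onRight-↑ˡ RR a | lookup-onRight-↑ʳ RR b | lookup-restrictR R b
            = countB-∷-≤ (lookup R) (a ↑ˡ k) ((m ↑ʳ b) ∷ [])
    ... | right a | left b
      rewrite lookup-onRight-↑ʳ ⊤ a | lookup-onRight-↑ˡ ⊤ b | lookup-replicate a inside
            | lookup-onRight-↑ʳ RR a | lookup-onRight-↑ˡ RR b | lookup-restrictR R a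
            = ≤-trans (≤-reflexive (countB-swap (lookup R) (m ↑ʳ a) (b ↑ˡ k) []))
                      (countB-∷-≤ (lookup R) (b ↑ˡ k) ((m ↑ʳ a) ∷ []))
    ... | right a | right b
      rewrite lookup-onRight-↑ʳ ⊤ a | lookup-onRight-↑ʳ ⊤ b | lookup-replicate a inside
            | lookup-replicate b inside | lookup-onRight-↑ʳ RR a | lookup-onRight-↑ʳ RR b
            | lookup-restrictR R a | lookup-restrictR R b
            = m≤n+m _ 2

    charge : ∀ M → countB (lookup R) (endpoints M) ≤
      countB (lookup RL) (endpoints (leftPairs M)) +
      (countB (lookup (onRight ⊤)) (endpoints M) + countB (lookup (onRight RR)) (endpoints M))
    charge []            = z≤n
    charge ((x , y) ∷ M) = begin
      countB (lookup R) ((x ∷ y ∷ []) ++ endpoints M)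
        ≡⟨ countB-++ (lookup R) (x ∷ y ∷ []) (endpoints M) ⟩
      countB (lookup R) (x ∷ y ∷ []) + countB (lookup R) (endpoints M)
        ≤⟨ +-mono-≤ (charge-pair x y) (charge M) ⟩
      (ℓ₁ + (r₁ + s₁)) + (ℓ₂ + (r₂ + s₂))
        ≡⟨ trans (interchange ℓ₁ (r₁ + s₁) ℓ₂ (r₂ + s₂))
                 (cong (ℓ₁ + ℓ₂ +_) (interchange r₁ s₁ r₂ s₂)) ⟩
      (ℓ₁ + ℓ₂) + ((r₁ + r₂) + (s₁ + s₂))
        ≡⟨ cong₂ _+_ (trans (cong (countB (lookup RL)) (endpoints-++ (leftPart x y) (leftPairs M)))
                            (countB-++ (lookup RL) (endpoints (leftPart x y)) (endpoints (leftPairs M))))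
                     (cong₂ _+_ (countB-++ (lookup (onRight ⊤)) (x ∷ y ∷ []) (endpoints M))
                                (countB-++ (lookup (onRight RR)) (x ∷ y ∷ []) (endpoints M))) ⟨
      countB (lookup RL) (endpoints (leftPart x y ++ leftPairs M)) +
      (countB (lookup (onRight ⊤)) ((x ∷ y ∷ []) ++ endpoints M) +
       countB (lookup (onRight RR)) ((x ∷ y ∷ []) ++ endpoints M)) ∎
      where
      open ≤-Reasoning
      ℓ₁ ℓ₂ r₁ r₂ s₁ s₂ : ℕ
      ℓ₁ = countB (lookup RL) (endpoints (leftPart x y))
      ℓ₂ = countB (lookup RL) (endpoints (leftPairs M))
      r₁ = countB (lookup (onRight ⊤)) (x ∷ y ∷ [])
      r₂ = countB (lookup (onRight ⊤)) (endpoints M)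
      s₁ = countB (lookup (onRight RR)) (x ∷ y ∷ [])
      s₂ = countB (lookup (onRight RR)) (endpoints M)

    matchedNum-join≤ : ∀ (GL : Graph m) (GR : Graph k) {CL} →
                       IsMaxMPD GL (nonIsolated GL) (RL ∩ nonIsolated GL) CL →
                       ∀ {M} → IsMPD (join GL GR) ⊤ M → matchedNum R M ≤ matchedNum RL CL + (k + ∣ RR ∣)
    matchedNum-join≤ GL GR {CL} (_ , maximal) {M} mpd = begin
      matchedNum R M
        ≡⟨ matchedNum≡countB R M (IsMPD.disjoint mpd) ⟩
      countB (lookup R) (endpoints M)
        ≤⟨ charge M ⟩
      countB (lookup RL) (endpoints LP) +
      (countB (lookup (onRight ⊤)) (endpoints M) + countB (lookup (onRight RR)) (endpoints M))
        ≤⟨ +-mono-≤ left-bound (+-mono-≤ (right-bound ⊤) (right-bound RR)) ⟩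
      matchedNum RL CL + (∣ ⊤ {k} ∣ + ∣ RR ∣)
        ≡⟨ cong (λ size → matchedNum RL CL + (size + ∣ RR ∣)) (∣⊤∣≡n k) ⟩
      matchedNum RL CL + (k + ∣ RR ∣) ∎
      where
      open ≤-Reasoning
      W : Subset m
      W = nonIsolated GL
      LP : List (Pair m)
      LP = leftPairs M
      LP-matching : IsMatching GL LP
      LP-matching = leftPairs-isMatching GL GR mpd
      extension : Σ (List (Pair m)) λ E → IsMPD GL W E × LP ⊆ E
      extension = extend GL LP LP-matching
      E : List (Pair m)
      E = proj₁ extension
      E-mpd : IsMPD GL W E
      E-mpd = proj₁ (proj₂ extension)
      LP⊆E : LP ⊆ E
      LP⊆E = proj₂ (proj₂ extension)

      right-bound : ∀ q → countB (lookup (onRight q)) (endpoints M) ≤ ∣ q ∣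
      right-bound q = ≤-trans (countB-endpoints≤∣ onRight q ∣ M (IsMPD.disjoint mpd))
                              (≤-reflexive (∣onRight∣ q))

      LP-hits⊆E-hits : vset LP ∩ RL ⊆ₛ vset E ∩ (RL ∩ W)
      LP-hits⊆E-hits x∈ with x∈p∩q⁻ (vset LP) RL x∈
      ... | x∈LP , x∈RL =
        x∈p∩q⁺ (∈-vset⁺ E x∈E , x∈p∩q⁺ (x∈RL , lookup⇒[]= _ W (IsMPD-endpoints E-mpd x∈E)))
        where x∈E = endpoints-⊆ LP⊆E (∈-vset⁻ LP x∈LP)

      CL-hits⊆ : vset CL ∩ (RL ∩ W) ⊆ₛ vset CL ∩ RL
      CL-hits⊆ x∈ with x∈p∩q⁻ (vset CL) (RL ∩ W) x∈
      ... | x∈CL , x∈RL∩W = x∈p∩q⁺ (x∈CL , proj₁ (x∈p∩q⁻ RL W x∈RL∩W))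

      left-bound : countB (lookup RL) (endpoints LP) ≤ matchedNum RL CL
      left-bound = begin
        countB (lookup RL) (endpoints LP)  ≡⟨ matchedNum≡countB RL LP (proj₂ LP-matching) ⟨
        matchedNum RL LP                   ≤⟨ p⊆q⇒∣p∣≤∣q∣ LP-hits⊆E-hits ⟩
        matchedNum (RL ∩ W) E              ≤⟨ maximal E E-mpd ⟩
        matchedNum (RL ∩ W) CL             ≤⟨ p⊆q⇒∣p∣≤∣q∣ CL-hits⊆ ⟩
        matchedNum RL CL                   ∎

    isFull-liftL : ∀ e → isFull R (liftL k e) ≡ isFull RL e
    isFull-liftL (a , b) rewrite lookup-restrictL R a | lookup-restrictL R b = refl

    isSemi-liftL : ∀ e → isSemi R (liftL k e) ≡ isSemi RL e
    isSemi-liftL (a , b) rewrite lookup-restrictL R a | lookup-restrictL R b = refl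

    isFree-liftL : ∀ e → isFree R (liftL k e) ≡ isFree RL e
    isFree-liftL (a , b) rewrite lookup-restrictL R a | lookup-restrictL R b = refl

    module Construction (GL : Graph m) (GR : Graph k) (CL : List (Pair m)) (u : Fin k → Fin m) where

      cross : Fin k → Pair (m + k)
      cross i = u i ↑ˡ k , m ↑ʳ i

      FS : List (Pair m)
      FS = fullSemi RL CL

      C : List (Pair (m + k))
      C = constructedCMPD RL CL u

      C-isMPD : IsMPD GL (nonIsolated GL) CL → Injective _≡_ _≡_ u → (∀ i → lookup (vset CL) (u i) ≡ false) →
                Fin k → IsMPD (join GL GR) ⊤ C
      C-isMPD CL-mpd u-inj u∉CL v = record { edges = edges ; disjoint = disjoint ; dominate = dominate }
        where
        FS⊑CL : FS ⊑ CL
        FS⊑CL = filterB-⊑ (λ e → not (isFree RL e)) CL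

        edges : ∀ {x y} → (x , y) ∈ C → Adj (join GL GR) x y × lookup ⊤ x ≡ true × lookup ⊤ y ≡ true
        edges {x} {y} xy∈ =
          adjacent (∈-++⁻ (map (liftL k) FS) xy∈) , lookup-replicate x inside , lookup-replicate y inside
          where
          adjacent : (x , y) ∈ map (liftL k) FS ⊎ (x , y) ∈ map cross (allFin k) → Adj (join GL GR) x y
          adjacent (inj₁ xy∈FS) with ∈-map⁻ (liftL k) xy∈FS
          ... | (a , b) , ab∈FS , refl =
            trans (adj-join-↑ˡ GL GR a b) (proj₁ (IsMPD.edges CL-mpd (Any-resp-⊆ FS⊑CL ab∈FS)))
          adjacent (inj₂ xy∈cross) with ∈-map⁻ cross xy∈cross
          ... | i , _ , refl = adj-join-↑ˡ↑ʳ GL GR (u i) i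

        disjoint : Unique (endpoints C)
        disjoint = subst Unique (sym (endpoints-++ (map (liftL k) FS) (map cross (allFin k))))
          (Unique.++⁺ lifted-unique cross-unique apart)
          where
          lifted-unique : Unique (endpoints (map (liftL k) FS))
          lifted-unique = subst Unique (sym (endpoints-liftL FS))
            (Unique.map⁺ (↑ˡ-injective k _ _) (Unique-resp-⊑ (endpoints-⊑ FS⊑CL) (IsMPD.disjoint CL-mpd)))
          cross-unique : Unique (endpoints (map cross (allFin k)))
          cross-unique = Unique-endpoints-map (u-inj ∘ ↑ˡ-injective k _ _) (↑ʳ-injective m _ _)
                                              (λ i j → ↑ˡ≢↑ʳ (u i) j) (Unique.allFin⁺ k)
          apart : ∀ {z} → ¬ (z ∈ endpoints (map (liftL k) FS) × z ∈ endpoints (map cross (allFin k)))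
          apart (z∈FS , z∈cross) with ∈-map⁻ (_↑ˡ k) (subst (_ ∈_) (endpoints-liftL FS) z∈FS)
                                     | ∈-endpoints-map⁻ (allFin k) z∈cross
          ... | a , a∈FS , refl | j , _ , inj₁ a↑≡uj↑ = contradiction
            (trans (sym ([]=⇒lookup (∈-vset⁺ CL (Any-resp-⊆ (endpoints-⊑ FS⊑CL) a∈FS))))
                   (subst (λ w → lookup (vset CL) w ≡ false) (sym (↑ˡ-injective k _ _ a↑≡uj↑)) (u∉CL j)))
            λ ()
          ... | a , a∈FS , refl | j , _ , inj₂ a↑≡m↑j = ↑ˡ≢↑ʳ a j a↑≡m↑j

        right∈C : ∀ j → lookup (vset C) (m ↑ʳ j) ≡ true
        right∈C j = []=⇒lookup (∈-vset⁺ C (proj₂ (∈-endpoints⁺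
          (∈-++⁺ʳ (map (liftL k) FS) (∈-map⁺ cross (∈-allFin j))))))

        dominate : ∀ x → lookup ⊤ x ≡ true → lookup (vset C) x ≡ false →
                   Σ (Fin (m + k)) λ y → lookup (vset C) y ≡ true × Adj (join GL GR) x y
        dominate x _ x∉C with side x
        ... | left a  = m ↑ʳ v , right∈C v , adj-join-↑ˡ↑ʳ GL GR a v
        ... | right b = contradiction (trans (sym (right∈C b)) x∉C) λ ()

      countB-C : ∀ (c : Pair (m + k) → Bool) →
                 countB c C ≡ countB (c ∘ liftL k) FS + countB (c ∘ cross) (allFin k)
      countB-C c = trans (countB-++ c (map (liftL k) FS) (map cross (allFin k)))
                         (cong₂ _+_ (countB-map c (liftL k) FS) (countB-map c cross (allFin k)))

      module _ (u∈RL : ∀ i → lookup RL (u i) ≡ true) where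

        private
          u↑∈R : ∀ i → lookup R (u i ↑ˡ k) ≡ true
          u↑∈R i = trans (sym (lookup-restrictL R (u i))) (u∈RL i)

        isFull-cross : ∀ i → isFull R (cross i) ≡ lookup RR i
        isFull-cross i rewrite u↑∈R i | lookup-restrictR R i = refl

        isSemi-cross : ∀ i → isSemi R (cross i) ≡ lookup (∁ RR) i
        isSemi-cross i rewrite u↑∈R i | lookup-map i not RR | lookup-restrictR R i = ∨-identityʳ _

        isFree-cross : ∀ i → isFree R (cross i) ≡ false
        isFree-cross i rewrite u↑∈R i = refl

        countB-endpoints-cross : ∀ is →
          countB (lookup R) (endpoints (map cross is)) ≡ length is + countB (lookup RR) is
        countB-endpoints-cross []       = refl
        countB-endpoints-cross (i ∷ is) rewrite u↑∈R i | sym (lookup-restrictR R i) with lookup RR i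
        ... | true  = cong suc (trans (cong suc (countB-endpoints-cross is)) (sym (+-suc _ _)))
        ... | false = cong suc (countB-endpoints-cross is)

        countB-endpoints-C : countB (lookup R) (endpoints C) ≡ countB (lookup RL) (endpoints CL) + (k + ∣ RR ∣)
        countB-endpoints-C = begin
          countB (lookup R) (endpoints C)
            ≡⟨ cong (countB (lookup R)) (endpoints-++ (map (liftL k) FS) (map cross (allFin k))) ⟩
          countB (lookup R) (endpoints (map (liftL k) FS) ++ endpoints (map cross (allFin k)))
            ≡⟨ countB-++ (lookup R) (endpoints (map (liftL k) FS)) (endpoints (map cross (allFin k))) ⟩
          countB (lookup R) (endpoints (map (liftL k) FS)) + countB (lookup R) (endpoints (map cross (allFin k)))
            ≡⟨ cong₂ _+_ lifted-count (countB-endpoints-cross (allFin k)) ⟩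
          countB (lookup RL) (endpoints CL) + (length (allFin k) + countB (lookup RR) (allFin k))
            ≡⟨ cong (countB (lookup RL) (endpoints CL) +_) (cong₂ _+_ (length-tabulate id) (countB-allFin RR)) ⟩
          countB (lookup RL) (endpoints CL) + (k + ∣ RR ∣) ∎
          where
          open ≡-Reasoning
          lifted-count : countB (lookup R) (endpoints (map (liftL k) FS)) ≡ countB (lookup RL) (endpoints CL)
          lifted-count = begin
            countB (lookup R) (endpoints (map (liftL k) FS)) ≡⟨ cong (countB (lookup R)) (endpoints-liftL FS) ⟩
            countB (lookup R) (map (_↑ˡ k) (endpoints FS))   ≡⟨ countB-map (lookup R) (_↑ˡ k) (endpoints FS) ⟩
            countB (lookup R ∘ (_↑ˡ k)) (endpoints FS)       ≡⟨ countB-cong (sym ∘ lookup-restrictL R) (endpoints FS) ⟩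
            countB (lookup RL) (endpoints FS)
              ≡⟨ countB-endpoints-filterB (lookup RL) _ CL (free⇒outside RL) ⟩
            countB (lookup RL) (endpoints CL)                ∎

        numFull-C : numFull R C ≡ numFull RL CL + ∣ RR ∣
        numFull-C = trans (countB-C (isFull R)) (cong₂ _+_
          (trans (countB-cong isFull-liftL FS) (countB-filterB-⊇ (isFull RL) _ (full⇒notFree RL) CL))
          (trans (countB-cong isFull-cross (allFin k)) (countB-allFin RR)))

        numSemi-C : numSemi R C ≡ numSemi RL CL + (k ∸ ∣ RR ∣)
        numSemi-C = trans (countB-C (isSemi R)) (cong₂ _+_
          (trans (countB-cong isSemi-liftL FS) (countB-filterB-⊇ (isSemi RL) _ (semi⇒notFree RL) CL))
          (trans (countB-cong isSemi-cross (allFin k)) (trans (countB-allFin (∁ RR)) (∣∁p∣≡n∸∣p∣ RR))))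

        numFree-C : numFree R C ≡ 0
        numFree-C = trans (countB-C (isFree R)) (cong₂ _+_
          (trans (countB-cong isFree-liftL FS) (countB-filterB-not (isFree RL) CL))
          (countB-false isFree-cross (allFin k)))

lemma6 : ∀ {nL nR} (GL : Graph (suc nL)) (GR : Graph (suc nR)) →
    IsCograph GL → IsCograph GR →
    (R : Subset (suc nL + suc nR)) →
    ∣ restrictR {suc nL} {suc nR} R ∣ < ∣ restrictL {suc nL} {suc nR} R ∣ →
    (CL : List (Pair (suc nL))) → (kL sL fL : ℕ) →
    IsCanonicalMPD GL (nonIsolated GL) (restrictL {suc nL} {suc nR} R ∩ nonIsolated GL) CL →
    numFull (restrictL {suc nL} {suc nR} R) CL ≡ kL →
    numSemi (restrictL {suc nL} {suc nR} R) CL ≡ sL →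
    numFree (restrictL {suc nL} {suc nR} R) CL ≡ fL →
    ∣ restrictR {suc nL} {suc nR} R ∣ + (suc nR ∸ ∣ restrictR {suc nL} {suc nR} R ∣)
      ≤ ∣ restrictL {suc nL} {suc nR} R ─ vset CL ∣ →
    (u : Fin (suc nR) → Fin (suc nL)) → Injective _≡_ _≡_ u →
    (∀ i → lookup (restrictL {suc nL} {suc nR} R) (u i) ≡ true) →
    (∀ i → lookup (vset CL) (u i) ≡ false) →
    IsCanonicalMPD (join GL GR) ⊤ R (constructedCMPD (restrictL {suc nL} {suc nR} R) CL u)
    × numFull R (constructedCMPD (restrictL {suc nL} {suc nR} R) CL u)
        ≡ kL + ∣ restrictR {suc nL} {suc nR} R ∣
    × numSemi R (constructedCMPD (restrictL {suc nL} {suc nR} R) CL u)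
        ≡ sL + (suc nR ∸ ∣ restrictR {suc nL} {suc nR} R ∣)
    × numFree R (constructedCMPD (restrictL {suc nL} {suc nR} R) CL u) ≡ 0
lemma6 {nL} {nR} GL GR _ _ R _ CL _ _ _ ((CL-mpd , CL-maximal) , _) refl refl _ _ u u-inj u∈RL u∉CL =
  ((C-mpd , maximal) , fewest-free) , numFull-C u∈RL , numSemi-C u∈RL , numFree-C u∈RL
  where
  open Restricted {suc nL} {suc nR} R
  open Construction GL GR CL u
  open ≤-Reasoning

  C-mpd : IsMPD (join GL GR) ⊤ C
  C-mpd = C-isMPD CL-mpd u-inj u∉CL zero

  maximal : ∀ M → IsMPD (join GL GR) ⊤ M → matchedNum R M ≤ matchedNum R C
  maximal M M-mpd = begin
    matchedNum R M
      ≤⟨ matchedNum-join≤ GL GR (CL-mpd , CL-maximal) M-mpd ⟩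
    matchedNum RL CL + (suc nR + ∣ RR ∣)
      ≡⟨ cong (_+ _) (matchedNum≡countB RL CL (IsMPD.disjoint CL-mpd)) ⟩
    countB (lookup RL) (endpoints CL) + (suc nR + ∣ RR ∣)
      ≡⟨ countB-endpoints-C u∈RL ⟨
    countB (lookup R) (endpoints C)
      ≡⟨ matchedNum≡countB R C (IsMPD.disjoint C-mpd) ⟨
    matchedNum R C ∎

  fewest-free : ∀ M → IsMaxMPD (join GL GR) ⊤ R M → numFree R C ≤ numFree R M
  fewest-free _ _ = ≤-trans (≤-reflexive (numFree-C u∈RL)) z≤n
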